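{- For every digraph $\vec H$ there is a digraph $\vec F$ such that (1) $\vec F$ can be obtained from $\vec H$ by a sequence of sink deletions, (2) $\alpha^*(\Gamma(\vec F))\ge\alpha^*(\Gamma(\vec H))$, and (3) $\vec F/\!\sim$ is a canonical DAG.
   Context: Digraphs are finite, no multiple arcs, loops allowed. $\vec H/\!\sim$ is the DAG obtained by contracting each strongly connected component (SCC) of $\vec H$ to a vertex and deleting loops. A sink deletion removes all vertices of an SCC $T$ that is a sink (outdegree $0$) of $\vec H/\!\sim$. With $S_1,\dots,S_k$ the SCCs that are sources of $\vec H/\!\sim$ and $s_i\in S_i$, the contour $\Gamma(\vec H)$ is the hypergraph with vertex set $V(\vec H)\setminus(S_1\cup\dots\cup S_k)$ and hyperedges the nonempty sets $R(s_i)\setminus S_i$ ($R(s)$: vertices reachable from $s$). $\alpha^*$ of a hypergraph is the maximum of $\sum_v\mu(v)$ over $\mu:V\to[0,1]$ with $\sum_{v\in e}\mu(v)\le1$ for every hyperedge $e$. A canonical DAG is a DAG in which every vertex has indegree $0$ or outdegree $0$.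
   Formalization: The weights μ in the definition of $\alpha^*$ take rational values in the unit interval rather than real ones. -}

module Defs where

open import Data.Bool using (Bool; true; false; T; if_then_else_)
open import Data.Fin using (Fin; zero; suc)
open import Data.Nat using (ℕ; zero; suc)
open import Data.Product using (Σ; _×_; ∃)
open import Data.Sum using (_⊎_)
open import Data.Empty using (⊥)
open import Relation.Nullary using (¬_)
open import Data.Rational using (ℚ; 0ℚ; 1ℚ; _+_; _≤_)
open import Relation.Binary.Construct.Closure.ReflexiveTransitive using (Star)

-- A digraph on the vertex set Fin n: arc relation as a Boolean matrix
-- (finite, no multiple arcs, loops allowed).
Digraph : ℕ → Set
Digraph n = Fin n → Fin n → Bool

VSet : ℕ → Set
VSet n = Fin n → Bool

_∈_ : ∀ {n} → Fin n → VSet n → Set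
v ∈ X = T (X v)

-- Digraphs obtained from H by deleting vertices are represented by the
-- induced subdigraph H[X] for a vertex set X.  All notions below refer
-- to the induced subdigraph H[X].

data Reach {n} (H : Digraph n) (X : VSet n) : Fin n → Fin n → Set where
  here : ∀ {u} → u ∈ X → Reach H X u u
  step : ∀ {u v w} → u ∈ X → T (H u v) → Reach H X v w → Reach H X u w

_∼[_,_]_ : ∀ {n} → Fin n → Digraph n → VSet n → Fin n → Set
u ∼[ H , X ] v = Reach H X u v × Reach H X v u

-- The SCC of t ∈ X is a sink of H[X]/∼ : no arc leaves it.
IsSinkSCC : ∀ {n} → Digraph n → VSet n → Fin n → Set
IsSinkSCC H X t = t ∈ X × (∀ u v → u ∼[ H , X ] t → v ∈ X → T (H u v) → v ∼[ H , X ] t)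

-- The SCC of s ∈ X is a source of H[X]/∼ : no arc enters it.
IsSourceSCC : ∀ {n} → Digraph n → VSet n → Fin n → Set
IsSourceSCC H X s = s ∈ X × (∀ u v → u ∈ X → v ∼[ H , X ] s → T (H u v) → u ∼[ H , X ] s)

SinkDeletion : ∀ {n} → Digraph n → VSet n → VSet n → Set
SinkDeletion H X Y =
  Σ _ λ t → IsSinkSCC H X t × (∀ v → (v ∈ Y → v ∈ X × ¬ (v ∼[ H , X ] t))
                                   × (v ∈ X × ¬ (v ∼[ H , X ] t) → v ∈ Y))

SinkDeletions : ∀ {n} → Digraph n → VSet n → VSet n → Set
SinkDeletions H = Star (SinkDeletion H)

-- Vertex set of the contour Γ(H[X]): vertices of X not in any source SCC.
InContour : ∀ {n} → Digraph n → VSet n → Fin n → Set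
InContour H X v = v ∈ X × (∀ s → IsSourceSCC H X s → ¬ (v ∼[ H , X ] s))

-- Hyperedge of Γ(H[X]) determined by a source vertex s: R(s) \ S(s).
-- (Every vertex of a source SCC gives the same set; an empty set only
-- gives a vacuous constraint, so indexing by all source vertices is harmless.)
InEdge : ∀ {n} → Digraph n → VSet n → Fin n → Fin n → Set
InEdge H X s v = Reach H X s v × ¬ (v ∼[ H , X ] s)

sumℚ : ∀ {n} → (Fin n → ℚ) → ℚ
sumℚ {zero} f = 0ℚ
sumℚ {suc n} f = f zero + sumℚ (λ i → f (suc i))

sumOver : ∀ {n} → VSet n → (Fin n → ℚ) → ℚ
sumOver χ μ = sumℚ (λ v → if χ v then μ v else 0ℚ)

Indicates : ∀ {n} → VSet n → (Fin n → Set) → Set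
Indicates χ P = ∀ v → (v ∈ χ → P v) × (P v → v ∈ χ)

-- Fractional independent set (feasible point of the LP defining α*)
-- of the contour Γ(H[X]), extended by 0 outside the contour vertex set.
FracIndep : ∀ {n} → Digraph n → VSet n → (Fin n → ℚ) → Set
FracIndep H X μ =
    (∀ v → 0ℚ ≤ μ v × μ v ≤ 1ℚ)
  × (∀ v → ¬ InContour H X v → μ v ≡ℚ 0ℚ)
  × (∀ s → IsSourceSCC H X s → ∀ χ → Indicates χ (InEdge H X s) → sumOver χ μ ≤ 1ℚ)
  where
    open import Relation.Binary.PropositionalEquality using () renaming (_≡_ to _≡ℚ_)

-- α*(Γ(H[Y])) ≥ α*(Γ(H[X])): every feasible value for Γ(H[X]) is matched
-- by a feasible value for Γ(H[Y]).  (The LP optimum is attained at a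
-- rational point, so quantifying over rational weights is exact.)
AlphaStarGE : ∀ {n} → Digraph n → VSet n → VSet n → Set
AlphaStarGE H Y X =
  ∀ μ → FracIndep H X μ → Σ (Fin _ → ℚ) λ ν → FracIndep H Y ν × sumℚ μ ≤ sumℚ ν

CanonicalQuotient : ∀ {n} → Digraph n → VSet n → Set
CanonicalQuotient H X = ∀ t → t ∈ X → IsSourceSCC H X t ⊎ IsSinkSCC H X t

full : ∀ {n} → VSet n
full _ = true

{-# OPTIONS --safe #-}
module Submission where

-- Repeatedly pick a vertex v whose strong component is neither a source nor a sink, and delete a
-- sink component reachable from v but not containing v; since the vertex set shrinks, this ends
-- with a canonical quotient. The remaining vertex set X stays closed under in-neighbours, so strong
-- components inside X and source components of H[X] are those of H. Throughout, every contour
-- vertex w of H has a representative: a contour vertex of H in X from which w is reachable (if the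
-- representative is deleted, v, which reaches it, takes over). Pushing a fractional independent set
-- of Γ(H) forward along w ↦ representative preserves its total weight, and a hyperedge of Γ(H[X])
-- only receives weight from the hyperedge of Γ(H) with the same source. The bound 1 at a single
-- vertex holds because in a canonical quotient every contour vertex lies in some hyperedge.

open import Defs
open import Data.Bool using (Bool; true; false; T; if_then_else_; not; _∧_)
open import Data.Bool.Properties using (T?)
open import Data.Empty using (⊥-elim)
open import Data.Fin using (Fin; zero; suc)
open import Data.Fin.Properties using (any?; all?) renaming (_≟_ to _≟ᶠ_)
open import Data.Nat as ℕ using (ℕ; zero; suc; z≤n; s≤s)
import Data.Nat.Properties as ℕ
open import Data.Nat.Induction using (<-wellFounded)
open import Data.Product using (Σ; _×_; _,_; proj₁; proj₂; ∃; ∃₂)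
open import Data.Rational using (ℚ; 0ℚ; 1ℚ; _+_; _≤_; _≤?_)
open import Data.Rational.Properties
  using ( ≤-refl; ≤-trans; ≤-reflexive; +-mono-≤; +-monoʳ-≤; +-identityˡ; +-identityʳ
        ; +-0-commutativeMonoid; module ≤-Reasoning)
open import Data.Sum using (_⊎_; inj₁; inj₂)
open import Data.Unit using (tt)
open import Function using (_∘_)
open import Induction.WellFounded using (Acc; acc)
open import Relation.Binary.Construct.Closure.ReflexiveTransitive using (ε; _◅_)
open import Relation.Binary.PropositionalEquality using (_≡_; refl; sym; trans; cong; cong₂; subst; module ≡-Reasoning)
open import Relation.Nullary using (¬_; Dec; yes; no; does; contradiction)
open import Relation.Nullary.Decidable using (_×-dec_; _→-dec_; ¬?; map′; decidable-stable; from-yes)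
open import Relation.Unary using (Decidable)
open import Algebra.Properties.CommutativeMonoid.Sum +-0-commutativeMonoid using (sum; sum-cong-≗; ∑-comm)

infix 4 _⊆_
_⊆_ : ∀ {n} → VSet n → VSet n → Set
X ⊆ Y = ∀ {v} → v ∈ X → v ∈ Y

indicator : Bool → ℕ
indicator b = if b then 1 else 0

indicator-mono : ∀ {x y} → (T x → T y) → indicator x ℕ.≤ indicator y
indicator-mono {false}        _   = z≤n
indicator-mono {true} {true}  _   = ℕ.≤-refl
indicator-mono {true} {false} x⇒y = ⊥-elim (x⇒y tt)

indicator-< : ∀ {x y} → ¬ T x → T y → indicator x ℕ.< indicator y
indicator-< {false} {true} _  _ = s≤s z≤n
indicator-< {true}         ¬x _ = ⊥-elim (¬x tt)

size : ∀ {n} → VSet n → ℕ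
size {zero}  X = 0
size {suc n} X = indicator (X zero) ℕ.+ size (X ∘ suc)

size-mono : ∀ {n} {X Y : VSet n} → X ⊆ Y → size X ℕ.≤ size Y
size-mono {zero}  X⊆Y = z≤n
size-mono {suc n} X⊆Y = ℕ.+-mono-≤ (indicator-mono (X⊆Y {zero})) (size-mono λ {v} → X⊆Y {suc v})

size-< : ∀ {n} {X Y : VSet n} {u} → X ⊆ Y → ¬ u ∈ X → u ∈ Y → size X ℕ.< size Y
size-< {u = zero}  X⊆Y u∉X u∈Y = ℕ.+-mono-<-≤ (indicator-< u∉X u∈Y) (size-mono λ {v} → X⊆Y {suc v})
size-< {u = suc u} X⊆Y u∉X u∈Y =
  ℕ.+-mono-≤-< (indicator-mono (X⊆Y {zero})) (size-< (λ {v} → X⊆Y {suc v}) u∉X u∈Y)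

module _ {n : ℕ} where

  infixl 6 _─_

  -- Opaque, so that membership goals keep the form v ∈ (X ─ P?) from which X and P? are inferred.
  opaque
    _─_ : VSet n → {P : Fin n → Set} → Decidable P → VSet n
    (X ─ P?) v = X v ∧ not (does (P? v))

    ∈─⁻ : ∀ {X : VSet n} {P} {P? : Decidable P} {v} → v ∈ (X ─ P?) → v ∈ X × ¬ P v
    ∈─⁻ {X} {P? = P?} {v} v∈ with X v | P? v
    ... | true | no ¬p = tt , ¬p

    ∈─⁺ : ∀ {X : VSet n} {P} {P? : Decidable P} {v} → v ∈ X → ¬ P v → v ∈ (X ─ P?)
    ∈─⁺ {X} {P? = P?} {v} v∈X ¬p with X v | P? v
    ... | true  | no _  = tt
    ... | true  | yes p = ¬p p

  size-─ : ∀ {X : VSet n} {P} {P? : Decidable P} {u} → u ∈ X → P u → size (X ─ P?) ℕ.< size X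
  size-─ {X} {P? = P?} u∈X p =
    size-< {X = X ─ P?} {X} (proj₁ ∘ ∈─⁻) (λ u∈X─P → proj₂ (∈─⁻ u∈X─P) p) u∈X

sumℚ≗sum : ∀ {n} (f : Fin n → ℚ) → sumℚ f ≡ sum f
sumℚ≗sum {zero}  f = refl
sumℚ≗sum {suc n} f = cong (f zero +_) (sumℚ≗sum (f ∘ suc))

sumℚ-comm : ∀ {m k} (F : Fin m → Fin k → ℚ) →
            sumℚ (λ i → sumℚ (F i)) ≡ sumℚ (λ j → sumℚ (λ i → F i j))
sumℚ-comm F = begin
  sumℚ (λ i → sumℚ (F i))          ≡⟨ sumℚ≗sum (λ i → sumℚ (F i)) ⟩
  sum (λ i → sumℚ (F i))           ≡⟨ sum-cong-≗ (λ i → sumℚ≗sum (F i)) ⟩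
  sum (λ i → sum (F i))            ≡⟨ ∑-comm F ⟩
  sum (λ j → sum (λ i → F i j))    ≡⟨ sum-cong-≗ (λ j → sumℚ≗sum (λ i → F i j)) ⟨
  sum (λ j → sumℚ (λ i → F i j))   ≡⟨ sumℚ≗sum (λ j → sumℚ (λ i → F i j)) ⟨
  sumℚ (λ j → sumℚ (λ i → F i j))  ∎
  where open ≡-Reasoning

sumℚ-cong : ∀ {n} {f g : Fin n → ℚ} → (∀ i → f i ≡ g i) → sumℚ f ≡ sumℚ g
sumℚ-cong {zero}  f≗g = refl
sumℚ-cong {suc n} f≗g = cong₂ _+_ (f≗g zero) (sumℚ-cong (f≗g ∘ suc))

sumℚ-zero : ∀ {n} {f : Fin n → ℚ} → (∀ i → f i ≡ 0ℚ) → sumℚ f ≡ 0ℚ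
sumℚ-zero {zero}  f≗0 = refl
sumℚ-zero {suc n} f≗0 = trans (cong₂ _+_ (f≗0 zero) (sumℚ-zero (f≗0 ∘ suc))) (+-identityˡ 0ℚ)

sumℚ-mono : ∀ {n} {f g : Fin n → ℚ} → (∀ i → f i ≤ g i) → sumℚ f ≤ sumℚ g
sumℚ-mono {zero}  f≤g = ≤-refl
sumℚ-mono {suc n} f≤g = +-mono-≤ (f≤g zero) (sumℚ-mono (f≤g ∘ suc))

sumℚ-nonneg : ∀ {n} {f : Fin n → ℚ} → (∀ i → 0ℚ ≤ f i) → 0ℚ ≤ sumℚ f
sumℚ-nonneg {n} {f} f≥0 = subst (_≤ sumℚ f) (sumℚ-zero {n} λ _ → refl) (sumℚ-mono f≥0)

≤-sumℚ : ∀ {n} {f : Fin n → ℚ} → (∀ i → 0ℚ ≤ f i) → ∀ i → f i ≤ sumℚ f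
≤-sumℚ {suc n} {f} f≥0 zero =
  subst (_≤ sumℚ f) (+-identityʳ (f zero)) (+-monoʳ-≤ (f zero) (sumℚ-nonneg (f≥0 ∘ suc)))
≤-sumℚ {suc n} {f} f≥0 (suc i) =
  subst (_≤ sumℚ f) (+-identityˡ (f (suc i))) (+-mono-≤ (f≥0 zero) (≤-sumℚ (f≥0 ∘ suc) i))

if-nonneg : ∀ b {x} → 0ℚ ≤ x → 0ℚ ≤ (if b then x else 0ℚ)
if-nonneg true  x≥0 = x≥0
if-nonneg false _   = ≤-refl

if-sumℚ : ∀ {n} b (g : Fin n → ℚ) → (if b then sumℚ g else 0ℚ) ≡ sumℚ (λ i → if b then g i else 0ℚ)
if-sumℚ true  g = refl
if-sumℚ {n} false g = sym (sumℚ-zero {n} λ _ → refl)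

if-zero : ∀ b → (if b then 0ℚ else 0ℚ) ≡ 0ℚ
if-zero true  = refl
if-zero false = refl

≤-sumOver : ∀ {n} {χ : VSet n} {f : Fin n → ℚ} → (∀ v → 0ℚ ≤ f v) → ∀ {v} → v ∈ χ → f v ≤ sumOver χ f
≤-sumOver {χ = χ} {f} f≥0 {v} v∈χ =
  subst (_≤ sumOver χ f) (selected (χ v) v∈χ) (≤-sumℚ (λ w → if-nonneg (χ w) (f≥0 w)) v)
  where
  selected : ∀ b → T b → (if b then f v else 0ℚ) ≡ f v
  selected true _ = refl

sumOver-mono : ∀ {n} {χ ψ : VSet n} {f : Fin n → ℚ} → (∀ v → 0ℚ ≤ f v) →
               (∀ {v} → v ∈ χ → v ∈ ψ ⊎ f v ≡ 0ℚ) → sumOver χ f ≤ sumOver ψ f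
sumOver-mono {χ = χ} {ψ} {f} f≥0 χ⊆ψ = sumℚ-mono λ v → termwise (χ v) (ψ v) (f≥0 v) χ⊆ψ
  where
  termwise : ∀ {v} b c → 0ℚ ≤ f v → (T b → T c ⊎ f v ≡ 0ℚ) →
             (if b then f v else 0ℚ) ≤ (if c then f v else 0ℚ)
  termwise false c    fv≥0 _   = if-nonneg c fv≥0
  termwise true  true _    _   = ≤-refl
  termwise true false _    b⇒c with b⇒c tt
  ... | inj₂ fv≡0 = ≤-reflexive fv≡0

point : ∀ {n} → Fin n → ℚ → Fin n → ℚ
point i x v = if does (i ≟ᶠ v) then x else 0ℚ

sumOver-point : ∀ {n} (χ : VSet n) i x → sumOver χ (point i x) ≡ (if χ i then x else 0ℚ)
sumOver-point {suc n} χ zero    x = begin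
  (if χ zero then x else 0ℚ) + sumOver (χ ∘ suc) (λ _ → 0ℚ)
    ≡⟨ cong ((if χ zero then x else 0ℚ) +_) (sumℚ-zero (if-zero ∘ χ ∘ suc)) ⟩
  (if χ zero then x else 0ℚ) + 0ℚ
    ≡⟨ +-identityʳ _ ⟩
  (if χ zero then x else 0ℚ)
    ∎
  where open ≡-Reasoning
sumOver-point {suc n} χ (suc i) x = begin
  (if χ zero then 0ℚ else 0ℚ) + sumOver (χ ∘ suc) (point i x)
    ≡⟨ cong₂ _+_ (if-zero (χ zero)) (sumOver-point (χ ∘ suc) i x) ⟩
  0ℚ + (if χ (suc i) then x else 0ℚ)
    ≡⟨ +-identityˡ _ ⟩
  (if χ (suc i) then x else 0ℚ)
    ∎
  where open ≡-Reasoning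

push : ∀ {m k} → (Fin m → Fin k) → (Fin m → ℚ) → Fin k → ℚ
push a f v = sumℚ (λ w → point (a w) (f w) v)

sumOver-push : ∀ {m k} (χ : VSet k) (a : Fin m → Fin k) (f : Fin m → ℚ) →
               sumOver χ (push a f) ≡ sumOver (χ ∘ a) f
sumOver-push χ a f = begin
  sumℚ (λ v → if χ v then sumℚ (λ w → point (a w) (f w) v) else 0ℚ)
    ≡⟨ sumℚ-cong (λ v → if-sumℚ (χ v) (λ w → point (a w) (f w) v)) ⟩
  sumℚ (λ v → sumℚ (λ w → if χ v then point (a w) (f w) v else 0ℚ))
    ≡⟨ sumℚ-comm (λ v w → if χ v then point (a w) (f w) v else 0ℚ) ⟩
  sumℚ (λ w → sumOver χ (point (a w) (f w)))
    ≡⟨ sumℚ-cong (λ w → sumOver-point χ (a w) (f w)) ⟩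
  sumOver (χ ∘ a) f
    ∎
  where open ≡-Reasoning

does-Indicates : ∀ {n} {P : Fin n → Set} (P? : Decidable P) → Indicates (does ∘ P?) P
does-Indicates P? v with P? v
... | yes p  = (λ _ → p) , (λ _ → tt)
... | no  ¬p = (λ ()) , ¬p

module _ {n : ℕ} (H : Digraph n) where

  private variable
    X Y : VSet n
    a s t u v w x y : Fin n

  Reach-start : Reach H X u v → u ∈ X
  Reach-start (here u∈X)     = u∈X
  Reach-start (step u∈X _ _) = u∈X

  Reach-end : Reach H X u v → v ∈ X
  Reach-end (here v∈X)   = v∈X
  Reach-end (step _ _ r) = Reach-end r

  infixr 5 _◅◅_
  _◅◅_ : Reach H X u v → Reach H X v w → Reach H X u w
  here _        ◅◅ r′ = r′
  step u∈X uv r ◅◅ r′ = step u∈X uv (r ◅◅ r′)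

  Reach-arc : Reach H X u v → T (H v w) → w ∈ X → Reach H X u w
  Reach-arc r vw w∈X = r ◅◅ step (Reach-end r) vw (here w∈X)

  Reach-mono : X ⊆ Y → Reach H X u v → Reach H Y u v
  Reach-mono X⊆Y (here u∈X)      = here (X⊆Y u∈X)
  Reach-mono X⊆Y (step u∈X uv r) = step (X⊆Y u∈X) uv (Reach-mono X⊆Y r)

  Reach-full : Reach H X u v → Reach H full u v
  Reach-full = Reach-mono (λ _ → tt)

  UpClosed : VSet n → Set
  UpClosed X = ∀ {u v} → v ∈ X → T (H u v) → u ∈ X

  Reach-restrict : UpClosed X → Reach H full u v → v ∈ X → Reach H X u v
  Reach-restrict up (here _)      v∈X = here v∈X
  Reach-restrict up (step _ uw r) v∈X = step (up (Reach-start r′) uw) uw r′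
    where r′ = Reach-restrict up r v∈X

  ∼-refl : u ∈ X → u ∼[ H , X ] u
  ∼-refl u∈X = here u∈X , here u∈X

  ∼-sym : u ∼[ H , X ] v → v ∼[ H , X ] u
  ∼-sym (uv , vu) = vu , uv

  ∼-trans : u ∼[ H , X ] v → v ∼[ H , X ] w → u ∼[ H , X ] w
  ∼-trans (uv , vu) (vw , wv) = uv ◅◅ vw , wv ◅◅ vu

  ∼-full : u ∼[ H , X ] v → u ∼[ H , full ] v
  ∼-full (uv , vu) = Reach-full uv , Reach-full vu

  ∼-restrict : UpClosed X → u ∼[ H , full ] v → v ∈ X → u ∼[ H , X ] v
  ∼-restrict up (uv , vu) v∈X = uv′ , Reach-restrict up vu (Reach-start uv′)
    where uv′ = Reach-restrict up uv v∈X

  Reach-avoiding : Reach H X a w → ¬ w ≡ u →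
    Reach H (X ─ (_≟ᶠ u)) a w ⊎ ∃ λ v → T (H u v) × Reach H (X ─ (_≟ᶠ u)) v w
  Reach-avoiding (here a∈X) w≢u = inj₁ (here (∈─⁺ a∈X w≢u))
  Reach-avoiding {u = u} (step {a} a∈X av r) w≢u with Reach-avoiding r w≢u | a ≟ᶠ u
  ... | inj₂ exit | _        = inj₂ exit
  ... | inj₁ r′   | yes refl = inj₂ (_ , av , r′)
  ... | inj₁ r′   | no a≢u   = inj₁ (step (∈─⁺ a∈X a≢u) av r′)

  Reach? : ∀ X u w → Dec (Reach H X u w)
  Reach? X = search X (<-wellFounded (size X))
    where
    search : ∀ X → Acc ℕ._<_ (size X) → ∀ u w → Dec (Reach H X u w)
    search X (acc rs) u w with T? (X u) | u ≟ᶠ w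
    ... | no u∉X  | _        = no (u∉X ∘ Reach-start)
    ... | yes u∈X | yes refl = yes (here u∈X)
    ... | yes u∈X | no u≢w   =
      map′ (λ (v , uv , r) → step u∈X uv (Reach-mono (proj₁ ∘ ∈─⁻) r)) first-exit
           (any? λ v → T? (H u v) ×-dec search (X ─ (_≟ᶠ u)) (rs (size-─ {X = X} u∈X refl)) v w)
      where
      first-exit : Reach H X u w → ∃ λ v → T (H u v) × Reach H (X ─ (_≟ᶠ u)) v w
      first-exit r with Reach-avoiding r (u≢w ∘ sym)
      ... | inj₁ r′   = contradiction refl (proj₂ (∈─⁻ (Reach-start r′)))
      ... | inj₂ exit = exit

  ∼? : ∀ X u v → Dec (u ∼[ H , X ] v)
  ∼? X u v = Reach? X u v ×-dec Reach? X v u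

  IsSourceSCC? : ∀ X s → Dec (IsSourceSCC H X s)
  IsSourceSCC? X s = T? (X s) ×-dec all? λ u → all? λ v →
    T? (X u) →-dec ∼? X v s →-dec T? (H u v) →-dec ∼? X u s

  IsSinkSCC? : ∀ X t → Dec (IsSinkSCC H X t)
  IsSinkSCC? X t = T? (X t) ×-dec all? λ u → all? λ v →
    ∼? X u t →-dec T? (X v) →-dec T? (H u v) →-dec ∼? X v t

  InContour? : ∀ X v → Dec (InContour H X v)
  InContour? X v = T? (X v) ×-dec all? λ s → IsSourceSCC? X s →-dec ¬? (∼? X v s)

  InEdge? : ∀ X s v → Dec (InEdge H X s v)
  InEdge? X s v = Reach? X s v ×-dec ¬? (∼? X v s)

  arc-leaving : t ∈ X → ¬ IsSinkSCC H X t →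
    ∃₂ λ u y → u ∼[ H , X ] t × y ∈ X × T (H u y) × ¬ y ∼[ H , X ] t
  arc-leaving {t} {X} t∈X ¬sink
    with any? (λ u → any? λ y → ∼? X u t ×-dec T? (X y) ×-dec T? (H u y) ×-dec ¬? (∼? X y t))
  ... | yes arc = arc
  ... | no ∄arc = contradiction (t∈X , closed) ¬sink
    where
    closed : ∀ u y → u ∼[ H , X ] t → y ∈ X → T (H u y) → y ∼[ H , X ] t
    closed u y u∼t y∈X uy = decidable-stable (∼? X y t) λ y≁t → ∄arc (u , y , u∼t , y∈X , uy , y≁t)

  arc-entering : s ∈ X → ¬ IsSourceSCC H X s →
    ∃₂ λ u y → u ∈ X × y ∼[ H , X ] s × T (H u y) × ¬ u ∼[ H , X ] s
  arc-entering {s} {X} s∈X ¬source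
    with any? (λ u → any? λ y → T? (X u) ×-dec ∼? X y s ×-dec T? (H u y) ×-dec ¬? (∼? X u s))
  ... | yes arc = arc
  ... | no ∄arc = contradiction (s∈X , closed) ¬source
    where
    closed : ∀ u y → u ∈ X → y ∼[ H , X ] s → T (H u y) → u ∼[ H , X ] s
    closed u y u∈X y∼s uy = decidable-stable (∼? X u s) λ u≁s → ∄arc (u , y , u∈X , y∼s , uy , u≁s)

  reachable-sink : x ∈ X → ∃ λ t → IsSinkSCC H X t × Reach H X x t
  reachable-sink {X = X} = descend (<-wellFounded _)
    where
    reachable : Fin n → VSet n
    reachable x = does ∘ Reach? X x

    ∈reachable⁺ : Reach H X x v → v ∈ reachable x
    ∈reachable⁺ {x} {v} = proj₂ (does-Indicates (Reach? X x) v)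

    ∈reachable⁻ : v ∈ reachable x → Reach H X x v
    ∈reachable⁻ {v} {x} = proj₁ (does-Indicates (Reach? X x) v)

    descend : Acc ℕ._<_ (size (reachable x)) → x ∈ X → ∃ λ t → IsSinkSCC H X t × Reach H X x t
    descend {x} (acc rs) x∈X with IsSinkSCC? X x
    ... | yes sink = x , sink , here x∈X
    ... | no ¬sink with arc-leaving x∈X ¬sink
    ... | u , y , u∼x , y∈X , uy , y≁x =
      let t , sink , y⇝t = descend (rs shrinks) y∈X in t , sink , x⇝y ◅◅ y⇝t
      where
      x⇝y : Reach H X x y
      x⇝y = Reach-arc (proj₂ u∼x) uy y∈X
      shrinks : size (reachable y) ℕ.< size (reachable x)
      shrinks = size-< {X = reachable y} {reachable x}
        (∈reachable⁺ ∘ (x⇝y ◅◅_) ∘ ∈reachable⁻)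
        (λ y⇝x → y≁x (∈reachable⁻ y⇝x , x⇝y))
        (∈reachable⁺ (here x∈X))

  sink-beyond : v ∈ X → ¬ IsSinkSCC H X v →
    ∃ λ t → IsSinkSCC H X t × Reach H X v t × ¬ v ∼[ H , X ] t
  sink-beyond {v = v} {X = X} v∈X ¬sink with arc-leaving v∈X ¬sink
  ... | u , y , u∼v , y∈X , uy , y≁v with reachable-sink y∈X
  ... | t , sink , y⇝t = t , sink , v⇝y ◅◅ y⇝t , λ (v⇝t , t⇝v) → y≁v (y⇝t ◅◅ t⇝v , v⇝y)
    where
    v⇝y : Reach H X v y
    v⇝y = Reach-arc (proj₂ u∼v) uy y∈X

  IsSourceSCC-full : UpClosed X → IsSourceSCC H X s → IsSourceSCC H full s
  IsSourceSCC-full up (s∈X , closed) = tt , λ u y _ y∼s uy →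
    let y∼ˣs = ∼-restrict up y∼s s∈X
    in ∼-full (closed u y (up (Reach-start (proj₁ y∼ˣs)) uy) y∼ˣs uy)

  InContour-restrict : UpClosed X → v ∈ X → InContour H full v → InContour H X v
  InContour-restrict up v∈X (_ , ≁sources) =
    v∈X , λ s source v∼s → ≁sources s (IsSourceSCC-full up source) (∼-full v∼s)

  ¬IsSourceSCC⇒InContour : UpClosed X → v ∈ X → ¬ IsSourceSCC H X v → InContour H full v
  ¬IsSourceSCC⇒InContour up v∈X ¬source = tt , λ s (_ , closed) v∼s →
    ¬source (v∈X , λ u y u∈X y∼v uy →
      ∼-restrict up (∼-trans (closed u y tt (∼-trans (∼-full y∼v) v∼s) uy) (∼-sym v∼s)) v∈X)

  Represents : VSet n → Fin n → Fin n → Set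
  Represents X v w = v ∈ X × InContour H full v × Reach H full v w

  -- The representative is chosen before the hypothesis on w, so proj₁ ∘ covers is a map on all vertices.
  Covers : VSet n → Set
  Covers X = ∀ w → ∃ λ v → InContour H full w → Represents X v w

  full-UpClosed : UpClosed full
  full-UpClosed _ _ = tt

  full-Covers : Covers full
  full-Covers w = w , λ w∈Γ → tt , w∈Γ , here tt

  _─[_] : VSet n → Fin n → VSet n
  X ─[ t ] = X ─ λ v → ∼? X v t

  ─[]-SinkDeletion : IsSinkSCC H X t → SinkDeletion H X (X ─[ t ])
  ─[]-SinkDeletion {t = t} sink = t , sink , λ v → ∈─⁻ , λ (v∈X , v≁t) → ∈─⁺ v∈X v≁t

  ─[]-UpClosed : UpClosed X → IsSinkSCC H X t → UpClosed (X ─[ t ])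
  ─[]-UpClosed up (_ , closed) v∈X─t uv with ∈─⁻ v∈X─t
  ... | v∈X , v≁t = ∈─⁺ (up v∈X uv) λ u∼t → v≁t (closed _ _ u∼t v∈X uv)

  ─[]-Covers : UpClosed X → Covers X → v ∈ X → ¬ IsSourceSCC H X v →
               Reach H X v t → ¬ v ∼[ H , X ] t → Covers (X ─[ t ])
  ─[]-Covers {X = X} {v = v} {t = t} up covers v∈X ¬source v⇝t v≁t w with covers w
  ... | r , represents with ∼? X r t
  ...   | no r≁t  = r , λ w∈Γ → let r∈X , rest = represents w∈Γ in ∈─⁺ r∈X r≁t , rest
  ...   | yes r∼t = v , λ w∈Γ → ∈─⁺ v∈X v≁t , ¬IsSourceSCC⇒InContour up v∈X ¬source ,
                                  Reach-full (v⇝t ◅◅ proj₂ r∼t) ◅◅ proj₂ (proj₂ (represents w∈Γ))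

  canonical? : ∀ X →
    CanonicalQuotient H X ⊎ ∃ λ v → v ∈ X × ¬ IsSourceSCC H X v × ¬ IsSinkSCC H X v
  canonical? X with any? (λ v → T? (X v) ×-dec ¬? (IsSourceSCC? X v) ×-dec ¬? (IsSinkSCC? X v))
  ... | yes middle = inj₂ middle
  ... | no ∄middle = inj₁ λ t t∈X → source-or-sink t t∈X (IsSourceSCC? X t) (IsSinkSCC? X t)
    where
    source-or-sink : ∀ t → t ∈ X → Dec (IsSourceSCC H X t) → Dec (IsSinkSCC H X t) →
                     IsSourceSCC H X t ⊎ IsSinkSCC H X t
    source-or-sink t _   (yes source) _         = inj₁ source
    source-or-sink t _   (no _)       (yes sink) = inj₂ sink
    source-or-sink t t∈X (no ¬source) (no ¬sink) = contradiction (t , t∈X , ¬source , ¬sink) ∄middle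

  canonicalise : ∀ X → Acc ℕ._<_ (size X) → UpClosed X → Covers X →
    Σ (VSet n) λ Y → SinkDeletions H X Y × UpClosed Y × Covers Y × CanonicalQuotient H Y
  canonicalise X (acc rs) up covers with canonical? X
  ... | inj₁ canonical = X , ε , up , covers , canonical
  ... | inj₂ (v , v∈X , ¬source , ¬sink) with sink-beyond v∈X ¬sink
  ... | t , sink , v⇝t , v≁t =
    let t∈X = proj₁ sink
        Y , deletions , rest = canonicalise (X ─[ t ]) (rs (size-─ {X = X} t∈X (∼-refl t∈X)))
                                 (─[]-UpClosed up sink) (─[]-Covers up covers v∈X ¬source v⇝t v≁t)
    in Y , ─[]-SinkDeletion sink ◅ deletions , rest

  contour-in-edge : CanonicalQuotient H X → InContour H X v →
                    ∃ λ s → IsSourceSCC H X s × InEdge H X s v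
  contour-in-edge canonical (v∈X , ≁sources)
    with arc-entering v∈X (λ source → ≁sources _ source (∼-refl v∈X))
  ... | u , y , u∈X , y∼v , uy , u≁v with canonical u u∈X
  ... | inj₁ source       = u , source , step u∈X uy (proj₁ y∼v) , u≁v ∘ ∼-sym
  ... | inj₂ (_ , closed) =
    contradiction (∼-sym (∼-trans (∼-sym y∼v) (closed u y (∼-refl u∈X) (Reach-start (proj₁ y∼v)) uy))) u≁v

  InEdge-full : UpClosed X → s ∈ X → Represents X v w → InEdge H X s v → InEdge H full s w
  InEdge-full up s∈X (v∈X , _ , v⇝w) (s⇝v , v≁s) =
    Reach-full s⇝v ◅◅ v⇝w , λ (w⇝s , s⇝w) → v≁s (∼-restrict up (v⇝w ◅◅ w⇝s , Reach-full s⇝v) s∈X)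

  module _ {X} (up : UpClosed X) (canonical : CanonicalQuotient H X)
           {a : Fin n → Fin n} (represents : ∀ w → InContour H full w → Represents X (a w) w) where

    push-FracIndep : ∀ {μ} → FracIndep H full μ → FracIndep H X (push a μ)
    push-FracIndep {μ} (bounds , support , edges) = (λ v → ν≥0 v , ν≤1 v) , ν-support , ν-edges
      where
      ν : Fin n → ℚ
      ν = push a μ

      μ≥0 : ∀ w → 0ℚ ≤ μ w
      μ≥0 = proj₁ ∘ bounds

      ν≥0 : ∀ v → 0ℚ ≤ ν v
      ν≥0 v = sumℚ-nonneg λ w → if-nonneg (does (a w ≟ᶠ v)) (μ≥0 w)

      ν-support : ∀ v → ¬ InContour H X v → ν v ≡ 0ℚ
      ν-support v v∉Γ = sumℚ-zero vanishes
        where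
        vanishes : ∀ w → point (a w) (μ w) v ≡ 0ℚ
        vanishes w with a w ≟ᶠ v | InContour? full w
        ... | no _     | _       = refl
        ... | yes _    | no w∉Γ  = support w w∉Γ
        ... | yes refl | yes w∈Γ =
          let aw∈X , aw∈Γ , _ = represents w w∈Γ in contradiction (InContour-restrict up aw∈X aw∈Γ) v∉Γ

      ν-edges : ∀ s → IsSourceSCC H X s → ∀ χ → Indicates χ (InEdge H X s) → sumOver χ ν ≤ 1ℚ
      ν-edges s source χ χ-edge = begin
        sumOver χ ν                        ≡⟨ sumOver-push χ a μ ⟩
        sumOver (χ ∘ a) μ                  ≤⟨ sumOver-mono μ≥0 lift ⟩
        sumOver (does ∘ InEdge? full s) μ  ≤⟨ edges s (IsSourceSCC-full up source) _ edge ⟩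
        1ℚ                                 ∎
        where
        open ≤-Reasoning
        edge : Indicates (does ∘ InEdge? full s) (InEdge H full s)
        edge = does-Indicates (InEdge? full s)
        lift : ∀ {w} → a w ∈ χ → w ∈ (does ∘ InEdge? full s) ⊎ μ w ≡ 0ℚ
        lift {w} aw∈χ with InContour? full w
        ... | no w∉Γ  = inj₂ (support w w∉Γ)
        ... | yes w∈Γ = inj₁ (proj₂ (edge w)
                          (InEdge-full up (proj₁ source) (represents w w∈Γ) (proj₁ (χ-edge (a w)) aw∈χ)))

      ν≤1 : ∀ v → ν v ≤ 1ℚ
      ν≤1 v with InContour? X v
      ... | no v∉Γ  = ≤-trans (≤-reflexive (ν-support v v∉Γ)) (from-yes (0ℚ ≤? 1ℚ))
      ... | yes v∈Γ =
        let s , source , v∈edge = contour-in-edge canonical v∈Γ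
            edge = does-Indicates (InEdge? X s)
        in ≤-trans (≤-sumOver ν≥0 (proj₂ (edge v) v∈edge)) (ν-edges s source _ edge)

  AlphaStarGE-canonical : UpClosed X → CanonicalQuotient H X → Covers X → AlphaStarGE H X full
  AlphaStarGE-canonical up canonical covers μ feasible =
    push (proj₁ ∘ covers) μ , push-FracIndep up canonical (proj₂ ∘ covers) feasible ,
    ≤-reflexive (sym (sumOver-push full (proj₁ ∘ covers) μ))

lemma35 : (n : ℕ) (H : Digraph n) →
    Σ (VSet n) λ Y →
      SinkDeletions H full Y × AlphaStarGE H Y full × CanonicalQuotient H Y
lemma35 n H =
  let Y , deletions , up , covers , canonical =
        canonicalise H full (<-wellFounded _) (full-UpClosed H) (full-Covers H)
  in Y , deletions , AlphaStarGE-canonical H up canonical covers , canonical
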